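{- Let $R$ be a Dedekind domain and let $I$ be a nonzero ideal of $R$ such that $R/I$ is finite and nontrivial. If $I$ is a prime ideal, then $d(G_{R/I})=1$. If $I$ is not a prime ideal and $I$ has no prime ideal divisor $P$ with $|R/P|=2$, then $d(G_{R/I})=2$.
   Context: $G_{R/I}$ is the unitary Cayley graph of $R/I$: vertex set $R/I$, with $a+I$, $b+I$ adjacent iff $a-b+I$ is a unit of $R/I$. $d$ denotes the diameter. -}

module Defs where

open import Level using (Level; _⊔_; suc)
open import Algebra.Bundles using (CommutativeRing)
open import Data.Nat using (ℕ; zero) renaming (suc to sucℕ; _<_ to _<ℕ_)
open import Data.Fin using (Fin)
open import Data.List using (List; []; _∷_)
open import Data.Product using (Σ; ∃; _×_; _,_)
open import Data.Sum using (_⊎_)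
open import Relation.Nullary using (¬_)
open import Relation.Unary using (Pred)
open import Relation.Binary.PropositionalEquality using (_≡_)

module _ {c ℓ : Level} (R : CommutativeRing c ℓ) where
  open CommutativeRing R

  Ideal-Pred : Set (suc (c ⊔ ℓ))
  Ideal-Pred = Pred Carrier (c ⊔ ℓ)

  record IsIdeal (I : Pred Carrier (c ⊔ ℓ)) : Set (c ⊔ ℓ) where
    field
      resp  : ∀ {x y} → x ≈ y → I x → I y
      zero∈ : I 0#
      +∈    : ∀ {x y} → I x → I y → I (x + y)
      *∈    : ∀ r {x} → I x → I (r * x)

  _⊆I_ : Pred Carrier (c ⊔ ℓ) → Pred Carrier (c ⊔ ℓ) → Set (c ⊔ ℓ)
  I ⊆I J = ∀ {x} → I x → J x

  NonzeroIdeal : Pred Carrier (c ⊔ ℓ) → Set (c ⊔ ℓ)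
  NonzeroIdeal I = ∃ λ x → I x × ¬ (x ≈ 0#)

  record IsPrimeIdeal (P : Pred Carrier (c ⊔ ℓ)) : Set (c ⊔ ℓ) where
    field
      isIdeal : IsIdeal P
      proper  : ¬ P 1#
      prime   : ∀ a b → P (a * b) → P a ⊎ P b

  IsMaximalIdeal : Pred Carrier (c ⊔ ℓ) → Set (suc (c ⊔ ℓ))
  IsMaximalIdeal M = IsIdeal M × ¬ M 1# ×
    (∀ (J : Pred Carrier (c ⊔ ℓ)) → IsIdeal J → M ⊆I J → (J ⊆I M) ⊎ J 1#)

  IsIntegralDomain : Set (c ⊔ ℓ)
  IsIntegralDomain = ¬ (1# ≈ 0#) × (∀ a b → a * b ≈ 0# → a ≈ 0# ⊎ b ≈ 0#)

  InSpan : List Carrier → Carrier → Set (c ⊔ ℓ)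
  InSpan []       x = Level.Lift (c ⊔ ℓ) (x ≈ 0#)
  InSpan (g ∷ gs) x = ∃ λ r → ∃ λ y → InSpan gs y × x ≈ r * g + y

  IsNoetherian : Set (suc (c ⊔ ℓ))
  IsNoetherian = ∀ (I : Pred Carrier (c ⊔ ℓ)) → IsIdeal I →
    ∃ λ (gs : List Carrier) →
      (∀ x → InSpan gs x → I x) × (∀ x → I x → InSpan gs x)

  -- Homogenised monic polynomial: for cs = [c_{n-1}, …, c_0],
  -- homPoly cs a b = a^n + c_{n-1} a^{n-1} b + … + c_0 b^n  = b^n P(a/b),
  -- where P(X) = X^n + c_{n-1} X^{n-1} + … + c_0.
  homPoly : List Carrier → Carrier → Carrier → Carrier
  homPoly cs a b = go 1# 1# cs
    where
    go : Carrier → Carrier → List Carrier → Carrier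
    go acc bp []       = acc
    go acc bp (k ∷ ks) = go (acc * a + k * (bp * b)) (bp * b) ks

  -- Integrally closed (in its field of fractions): if a/b (b ≠ 0) is a root
  -- of a monic polynomial over R, then a/b ∈ R, i.e. b divides a.
  IsIntegrallyClosed : Set (c ⊔ ℓ)
  IsIntegrallyClosed = ∀ a b → ¬ (b ≈ 0#) → ∀ (cs : List Carrier) →
    homPoly cs a b ≈ 0# → ∃ λ r → a ≈ r * b

  IsDedekindDomain : Set (suc (c ⊔ ℓ))
  IsDedekindDomain = IsIntegralDomain × IsNoetherian × IsIntegrallyClosed ×
    (∀ (P : Pred Carrier (c ⊔ ℓ)) → IsPrimeIdeal P → NonzeroIdeal P → IsMaximalIdeal P)

  module _ (I : Pred Carrier (c ⊔ ℓ)) where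
    _≡I_ : Carrier → Carrier → Set (c ⊔ ℓ)
    x ≡I y = I (x - y)

    -- |R/I| = n : a bijection Fin n ≅ R/I given by representatives
    QuotCard : ℕ → Set (c ⊔ ℓ)
    QuotCard n = Σ (Fin n → Carrier) λ f →
      (∀ x → ∃ λ i → x ≡I f i) × (∀ i j → f i ≡I f j → i ≡ j)

    FiniteQuot : Set (c ⊔ ℓ)
    FiniteQuot = ∃ λ n → QuotCard n

    IsUnitMod : Carrier → Set (c ⊔ ℓ)
    IsUnitMod x = ∃ λ y → (x * y) ≡I 1#

    Adj : Carrier → Carrier → Set (c ⊔ ℓ)
    Adj a b = IsUnitMod (a - b)

    -- Dist≤ k a b : there is a walk of length ≤ k from a+I to b+I in G_{R/I}
    Dist≤ : ℕ → Carrier → Carrier → Set (c ⊔ ℓ)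
    Dist≤ zero     a b = a ≡I b
    Dist≤ (sucℕ k) a b = Dist≤ k a b ⊎ (∃ λ z → Adj a z × Dist≤ k z b)

    -- the diameter of G_{R/I} equals d: all distances ≤ d, and some pair
    -- of vertices is at distance exactly d.
    HasDiameter : ℕ → Set (c ⊔ ℓ)
    HasDiameter d = (∀ a b → Dist≤ d a b) ×
      (∃ λ a → ∃ λ b → ∀ k → k <ℕ d → ¬ Dist≤ k a b)

-- B = R/I is a finite commutative ring. If I is prime, B is a finite domain, hence a field
-- (some power of x is idempotent, so 0 or 1), and distinct vertices are adjacent.
-- Otherwise a - b = u + v with u, v units gives the path a, a - u, b, and a nonzero non-unit
-- (which exists as B is not a field) is not within distance 1 of 0. Every element of B is
-- a sum of two units: a nontrivial idempotent g splits B as B/Ann g × B/Ann (1 - g), two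
-- strictly smaller quotients of R; if there is none, B is local, every element a unit or
-- nilpotent, and the non-units form an ideal whose residue field has more than two elements.
module Submission where

open import Defs
open import Level using (Level; _⊔_) renaming (suc to lsuc)
open import Algebra.Bundles using (CommutativeRing; RawRing)
open import Algebra.Structures using (IsCommutativeRing)
open import Algebra.Solver.Ring.AlmostCommutativeRing
  using (fromCommutativeRing; _-Raw-AlmostCommutative⟶_)
open import Data.Bool using (if_then_else_)
open import Data.Fin using (Fin; toℕ) renaming (zero to fzero; suc to fsuc)
import Data.Fin.Properties as Fin
open import Data.Fin.Subset using (Subset; inside; outside; _∈_; _⊂_; _⊃_)
open import Data.Fin.Subset.Induction using (⊃-wellFounded)
open import Data.Integer as ℤ using (ℤ; +_; -[1+_]; 0ℤ; 1ℤ)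
import Data.Integer.Properties as ℤ
open import Data.Maybe using (Maybe; just; nothing)
open import Data.Nat as ℕ using (ℕ; zero; suc; z≤n; s≤s; _<_)
import Data.Nat.Properties as ℕ
open import Data.Product using (∃; _×_; _,_; proj₁; proj₂)
open import Data.Sign as Sign using (Sign)
open import Data.Sum using (_⊎_; inj₁; inj₂; [_,_]′; map)
open import Data.Vec using (tabulate)
open import Data.Vec.Properties using (lookup∘tabulate; []=⇒lookup; lookup⇒[]=)
open import Function using (_∘_)
open import Induction.WellFounded using (Acc; acc)
open import Relation.Binary.Core using (Rel)
open import Relation.Binary.Definitions using () renaming (Decidable to Decidable₂)
open import Relation.Binary.PropositionalEquality as ≡ using (_≡_)
open import Relation.Nullary using (¬_; Dec; yes; no; does; contradiction)
open import Relation.Nullary.Decidable using (map′; _×-dec_; ¬?)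
open import Relation.Unary using (Pred; Decidable)

-- Algebra.Solver.Ring needs coefficients with (weakly) decidable equality; ℤ maps into every
-- commutative ring. The type-checking-optimised _·_ makes ⟦ + 1 ⟧ reduce to 1#, so that the
-- solver's `con 1ℤ` is literally 1#.
module IntegerCoefficientSolver {c ℓ : Level} (R : CommutativeRing c ℓ) where
  open CommutativeRing R hiding (zero)
  open import Algebra.Properties.Ring ring
    using (-‿distribˡ-*; -‿distribʳ-*; -0#≈0#; -‿involutive; -‿+-comm)
  open import Algebra.Properties.Semiring.Mult.TCOptimised semiring using (1+×; ×-homo-+; ×1-homo-*)
    renaming (_×_ to _·_)
  open import Algebra.Properties.CommutativeSemigroup +-commutativeSemigroup using (interchange)
  open import Relation.Binary.Reasoning.Setoid setoid

  ⟦_⟧ : ℤ → Carrier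
  ⟦ + n ⟧    = n · 1#
  ⟦ -[1+ n ] ⟧ = - (suc n · 1#)

  -‿homo : ∀ i → ⟦ ℤ.- i ⟧ ≈ - ⟦ i ⟧
  -‿homo (+ zero)   = sym -0#≈0#
  -‿homo (+ suc n)  = refl
  -‿homo -[1+ n ]   = sym (-‿involutive _)

  ⊖-homo : ∀ m n → ⟦ m ℤ.⊖ n ⟧ ≈ m · 1# - n · 1#
  ⊖-homo zero n = begin
    ⟦ zero ℤ.⊖ n ⟧  ≡⟨ ≡.cong ⟦_⟧ (ℤ.⊖-≤ {0} {n} z≤n) ⟩
    ⟦ ℤ.- + n ⟧     ≈⟨ -‿homo (+ n) ⟩
    - (n · 1#)      ≈⟨ +-identityˡ _ ⟨
    0# - n · 1#     ∎
  ⊖-homo (suc m) zero = begin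
    suc m · 1#        ≈⟨ +-identityʳ _ ⟨
    suc m · 1# + 0#   ≈⟨ +-congˡ -0#≈0# ⟨
    suc m · 1# - 0#   ∎
  ⊖-homo (suc m) (suc n) = begin
    ⟦ suc m ℤ.⊖ suc n ⟧               ≡⟨ ≡.cong ⟦_⟧ (ℤ.[1+m]⊖[1+n]≡m⊖n m n) ⟩
    ⟦ m ℤ.⊖ n ⟧                       ≈⟨ ⊖-homo m n ⟩
    m · 1# - n · 1#                   ≈⟨ +-identityˡ _ ⟨
    0# + (m · 1# - n · 1#)            ≈⟨ +-congʳ (-‿inverseʳ 1#) ⟨
    (1# - 1#) + (m · 1# - n · 1#)     ≈⟨ interchange 1# (- 1#) (m · 1#) (- (n · 1#)) ⟩
    (1# + m · 1#) + (- 1# - n · 1#)   ≈⟨ +-congˡ (-‿+-comm 1# (n · 1#)) ⟩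
    (1# + m · 1#) - (1# + n · 1#)     ≈⟨ +-cong (1+× m 1#) (-‿cong (1+× n 1#)) ⟨
    suc m · 1# - suc n · 1#           ∎

  +-homo : ∀ i j → ⟦ i ℤ.+ j ⟧ ≈ ⟦ i ⟧ + ⟦ j ⟧
  +-homo (+ m)    (+ n)    = ×-homo-+ 1# m n
  +-homo (+ m)    -[1+ n ] = ⊖-homo m (suc n)
  +-homo -[1+ m ] (+ n)    = trans (⊖-homo n (suc m)) (+-comm _ _)
  +-homo -[1+ m ] -[1+ n ] = begin
    - (suc (suc (m ℕ.+ n)) · 1#)       ≡⟨ ≡.cong (λ k → - (k · 1#)) (ℕ.+-suc (suc m) n) ⟨
    - ((suc m ℕ.+ suc n) · 1#)         ≈⟨ -‿cong (×-homo-+ 1# (suc m) (suc n)) ⟩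
    - (suc m · 1# + suc n · 1#)        ≈⟨ -‿+-comm _ _ ⟨
    - (suc m · 1#) + - (suc n · 1#)    ∎

  signed : Sign → Carrier → Carrier
  signed Sign.+ x = x
  signed Sign.- x = - x

  signed-cong : ∀ s {x y} → x ≈ y → signed s x ≈ signed s y
  signed-cong Sign.+ = λ x≈y → x≈y
  signed-cong Sign.- = -‿cong

  signed-* : ∀ s t x y → signed (s Sign.* t) (x * y) ≈ signed s x * signed t y
  signed-* Sign.+ Sign.+ x y = refl
  signed-* Sign.+ Sign.- x y = -‿distribʳ-* x y
  signed-* Sign.- Sign.+ x y = -‿distribˡ-* x y
  signed-* Sign.- Sign.- x y = begin
    x * y          ≈⟨ -‿involutive _ ⟨
    - - (x * y)    ≈⟨ -‿cong (-‿distribˡ-* x y) ⟩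
    - (- x * y)    ≈⟨ -‿distribʳ-* (- x) y ⟩
    - x * - y      ∎

  ◃-homo : ∀ s n → ⟦ s ℤ.◃ n ⟧ ≈ signed s (n · 1#)
  ◃-homo Sign.+ zero    = refl
  ◃-homo Sign.- zero    = sym -0#≈0#
  ◃-homo Sign.+ (suc n) = refl
  ◃-homo Sign.- (suc n) = refl

  ⟦⟧-signed : ∀ i → ⟦ i ⟧ ≈ signed (ℤ.sign i) (ℤ.∣ i ∣ · 1#)
  ⟦⟧-signed (+ n)    = refl
  ⟦⟧-signed -[1+ n ] = refl

  *-homo : ∀ i j → ⟦ i ℤ.* j ⟧ ≈ ⟦ i ⟧ * ⟦ j ⟧
  *-homo i j = begin
    ⟦ s ℤ.◃ (∣i∣ ℕ.* ∣j∣) ⟧                               ≈⟨ ◃-homo s (∣i∣ ℕ.* ∣j∣) ⟩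
    signed s ((∣i∣ ℕ.* ∣j∣) · 1#)                          ≈⟨ signed-cong s (×1-homo-* ∣i∣ ∣j∣) ⟩
    signed s (∣i∣ · 1# * ∣j∣ · 1#)                          ≈⟨ signed-* (ℤ.sign i) (ℤ.sign j) _ _ ⟩
    signed (ℤ.sign i) (∣i∣ · 1#) * signed (ℤ.sign j) (∣j∣ · 1#) ≈⟨ *-cong (⟦⟧-signed i) (⟦⟧-signed j) ⟨
    ⟦ i ⟧ * ⟦ j ⟧                                           ∎
    where
    s = ℤ.sign i Sign.* ℤ.sign j
    ∣i∣ = ℤ.∣ i ∣
    ∣j∣ = ℤ.∣ j ∣

  ℤ-rawRing : RawRing _ _
  ℤ-rawRing = record
    { Carrier = ℤ ; _≈_ = _≡_ ; _+_ = ℤ._+_ ; _*_ = ℤ._*_ ; -_ = ℤ.-_ ; 0# = + 0 ; 1# = + 1 }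

  ⟦⟧-homomorphism : ℤ-rawRing -Raw-AlmostCommutative⟶ fromCommutativeRing R
  ⟦⟧-homomorphism = record
    { ⟦_⟧ = ⟦_⟧ ; +-homo = +-homo ; *-homo = *-homo ; -‿homo = -‿homo ; 0-homo = refl ; 1-homo = refl }

  ⟦⟧-≟ : ∀ i j → Maybe (⟦ i ⟧ ≈ ⟦ j ⟧)
  ⟦⟧-≟ i j with i ℤ.≟ j
  ... | yes ≡.refl = just refl
  ... | no _       = nothing

  open import Algebra.Solver.Ring ℤ-rawRing (fromCommutativeRing R) ⟦⟧-homomorphism ⟦⟧-≟ public
    using (solve; _:+_; _:*_; _:-_; :-_; _:=_; con)

module QuotientRing {c ℓ : Level} (R : CommutativeRing c ℓ)
  {I : Pred (CommutativeRing.Carrier R) (c ⊔ ℓ)} (I-ideal : IsIdeal R I) where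
  open CommutativeRing R
  open IsIdeal I-ideal
  open import Algebra.Properties.Ring ring using (-1*x≈-x)
  open IntegerCoefficientSolver R

  infix 4 _≋_
  _≋_ : Rel Carrier (c ⊔ ℓ)
  x ≋ y = I (x - y)

  ≈⇒≋ : ∀ {x y} → x ≈ y → x ≋ y
  ≈⇒≋ {x} {y} x≈y = resp (sym (trans (+-congʳ x≈y) (-‿inverseʳ y))) zero∈

  -∈ : ∀ {x} → I x → I (- x)
  -∈ {x} x∈I = resp (-1*x≈-x x) (*∈ (- 1#) x∈I)

  ≋-sym : ∀ {x y} → x ≋ y → y ≋ x
  ≋-sym {x} {y} x≋y = resp (solve 2 (λ x y → :- (x :- y) := y :- x) refl x y) (-∈ x≋y)

  ≋-trans : ∀ {x y z} → x ≋ y → y ≋ z → x ≋ z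
  ≋-trans {x} {y} {z} x≋y y≋z =
    resp (solve 3 (λ x y z → (x :- y) :+ (y :- z) := x :- z) refl x y z) (+∈ x≋y y≋z)

  +-cong≋ : ∀ {x x′ y y′} → x ≋ x′ → y ≋ y′ → x + y ≋ x′ + y′
  +-cong≋ {x} {x′} {y} {y′} x≋x′ y≋y′ = resp
    (solve 4 (λ x x′ y y′ → (x :- x′) :+ (y :- y′) := (x :+ y) :- (x′ :+ y′)) refl x x′ y y′)
    (+∈ x≋x′ y≋y′)

  *-cong≋ : ∀ {x x′ y y′} → x ≋ x′ → y ≋ y′ → x * y ≋ x′ * y′
  *-cong≋ {x} {x′} {y} {y′} x≋x′ y≋y′ = resp
    (solve 4 (λ x x′ y y′ → y :* (x :- x′) :+ x′ :* (y :- y′) := x :* y :- x′ :* y′) refl x x′ y y′)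
    (+∈ (*∈ y x≋x′) (*∈ x′ y≋y′))

  -‿cong≋ : ∀ {x x′} → x ≋ x′ → - x ≋ - x′
  -‿cong≋ {x} {x′} x≋x′ = resp (solve 2 (λ x x′ → :- (x :- x′) := :- x :- :- x′) refl x x′) (-∈ x≋x′)

  ≋-isCommutativeRing : IsCommutativeRing _≋_ _+_ _*_ -_ 0# 1#
  ≋-isCommutativeRing = record
    { isRing = record
      { +-isAbelianGroup = record
        { isGroup = record
          { isMonoid = record
            { isSemigroup = record
              { isMagma = record
                { isEquivalence = record { refl = ≈⇒≋ refl ; sym = ≋-sym ; trans = ≋-trans }
                ; ∙-cong = +-cong≋
                }
              ; assoc = λ x y z → ≈⇒≋ (+-assoc x y z)
              }
            ; identity = ≈⇒≋ ∘ +-identityˡ , ≈⇒≋ ∘ +-identityʳ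
            }
          ; inverse = ≈⇒≋ ∘ -‿inverseˡ , ≈⇒≋ ∘ -‿inverseʳ
          ; ⁻¹-cong = -‿cong≋
          }
        ; comm = λ x y → ≈⇒≋ (+-comm x y)
        }
      ; *-cong = *-cong≋
      ; *-assoc = λ x y z → ≈⇒≋ (*-assoc x y z)
      ; *-identity = ≈⇒≋ ∘ *-identityˡ , ≈⇒≋ ∘ *-identityʳ
      ; distrib = (λ x y z → ≈⇒≋ (distribˡ x y z)) , (λ x y z → ≈⇒≋ (distribʳ x y z))
      }
    ; *-comm = λ x y → ≈⇒≋ (*-comm x y)
    }

  R/I : CommutativeRing c (c ⊔ ℓ)
  R/I = record { isCommutativeRing = ≋-isCommutativeRing }

  ∈⇒≋0 : ∀ {x} → I x → x ≋ 0#
  ∈⇒≋0 {x} = resp (solve 1 (λ x → x := x :- con 0ℤ) refl x)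

  ≋0⇒∈ : ∀ {x} → x ≋ 0# → I x
  ≋0⇒∈ {x} = resp (solve 1 (λ x → x :- con 0ℤ := x) refl x)

  module _ {K : Pred Carrier (c ⊔ ℓ)} (K-ideal : IsIdeal R/I K) where
    private module K = IsIdeal K-ideal

    isIdeal-lift : IsIdeal R K
    isIdeal-lift = record { resp = K.resp ∘ ≈⇒≋ ; zero∈ = K.zero∈ ; +∈ = K.+∈ ; *∈ = K.*∈ }

    ⊆-lift : _⊆I_ R I K
    ⊆-lift x∈I = K.resp (≋-sym (∈⇒≋0 x∈I)) K.zero∈

  isPrimeIdeal-lift : ∀ {P} → IsPrimeIdeal R/I P → IsPrimeIdeal R P
  isPrimeIdeal-lift P-prime = record
    { isIdeal = isIdeal-lift isIdeal ; proper = proper ; prime = prime }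
    where open IsPrimeIdeal P-prime

  isPrimeIdeal⇒isIntegralDomain : IsPrimeIdeal R I → IsIntegralDomain R/I
  isPrimeIdeal⇒isIntegralDomain I-prime =
    proper ∘ ≋0⇒∈ , λ a b ab≋0 → map ∈⇒≋0 ∈⇒≋0 (prime a b (≋0⇒∈ ab≋0))
    where open IsPrimeIdeal I-prime

  isIntegralDomain⇒isPrimeIdeal : IsIntegralDomain R/I → IsPrimeIdeal R I
  isIntegralDomain⇒isPrimeIdeal (1≉0 , domain) = record
    { isIdeal = I-ideal
    ; proper = 1≉0 ∘ ∈⇒≋0
    ; prime = λ a b ab∈I → map ≋0⇒∈ ≋0⇒∈ (domain a b (∈⇒≋0 ab∈I))
    }

  ∈-resp-≋ : ∀ {x y} → x ≋ y → I x → I y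
  ∈-resp-≋ x≋y x∈I = ≋0⇒∈ (≋-trans (≋-sym x≋y) (∈⇒≋0 x∈I))

module UnitsAndNilpotents {b ℓ : Level} (B : CommutativeRing b ℓ) where
  open CommutativeRing B
  open import Algebra.Properties.Semiring.Exp semiring using (_^_)
  open import Algebra.Properties.CommutativeSemiring.Exp commutativeSemiring using (^-distrib-*)
  open IntegerCoefficientSolver B
  open import Relation.Binary.Reasoning.Setoid setoid

  Unit : Pred Carrier (b ⊔ ℓ)
  Unit x = ∃ λ y → x * y ≈ 1#

  Nilpotent : Pred Carrier ℓ
  Nilpotent x = ∃ λ k → x ^ k ≈ 0#

  Idempotent : Pred Carrier ℓ
  Idempotent e = e * e ≈ e

  SumOfTwoUnits : Pred Carrier (b ⊔ ℓ)
  SumOfTwoUnits t = ∃ λ u → Unit u × Unit (t - u)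

  unit-resp : ∀ {x y} → x ≈ y → Unit x → Unit y
  unit-resp x≈y (z , xz≈1) = z , trans (*-congʳ (sym x≈y)) xz≈1

  unit-1 : Unit 1#
  unit-1 = 1# , *-identityˡ 1#

  unit-* : ∀ {x y} → Unit x → Unit y → Unit (x * y)
  unit-* {x} {y} (x′ , xx′≈1) (y′ , yy′≈1) = x′ * y′ , (begin
    (x * y) * (x′ * y′)  ≈⟨ solve 4 (λ x y x′ y′ → (x :* y) :* (x′ :* y′) := (x :* x′) :* (y :* y′)) refl x y x′ y′ ⟩
    (x * x′) * (y * y′)  ≈⟨ *-cong xx′≈1 yy′≈1 ⟩
    1# * 1#              ≈⟨ *-identityˡ 1# ⟩
    1#                   ∎)

  unit-*-cancelˡ : ∀ {x y} → Unit (x * y) → Unit y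
  unit-*-cancelˡ {x} {y} (z , xyz≈1) =
    x * z , trans (solve 3 (λ x y z → y :* (x :* z) := (x :* y) :* z) refl x y z) xyz≈1

  unit-neg : ∀ {x} → Unit x → Unit (- x)
  unit-neg {x} (y , xy≈1) = - y , trans (solve 2 (λ x y → (:- x) :* (:- y) := x :* y) refl x y) xy≈1

  nilpotent-*ˡ : ∀ a {z} → Nilpotent z → Nilpotent (a * z)
  nilpotent-*ˡ a {z} (k , zᵏ≈0) = k , (begin
    (a * z) ^ k    ≈⟨ ^-distrib-* a z k ⟩
    a ^ k * z ^ k  ≈⟨ *-congˡ zᵏ≈0 ⟩
    a ^ k * 0#     ≈⟨ zeroʳ _ ⟩
    0#             ∎)

  geometricSum : Carrier → ℕ → Carrier
  geometricSum w zero    = 0#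
  geometricSum w (suc k) = 1# + w * geometricSum w k

  geometricSum-telescopes : ∀ w k → (1# - w) * geometricSum w k ≈ 1# - w ^ k
  geometricSum-telescopes w zero = solve 1 (λ w → (con 1ℤ :- w) :* con 0ℤ := con 1ℤ :- con 1ℤ) refl w
  geometricSum-telescopes w (suc k) = begin
    (1# - w) * (1# + w * S)
      ≈⟨ solve 2 (λ w S → (con 1ℤ :- w) :* (con 1ℤ :+ w :* S)
                         := (con 1ℤ :- w) :+ w :* ((con 1ℤ :- w) :* S)) refl w S ⟩
    (1# - w) + w * ((1# - w) * S)
      ≈⟨ +-congˡ (*-congˡ (geometricSum-telescopes w k)) ⟩
    (1# - w) + w * (1# - w ^ k)
      ≈⟨ solve 2 (λ w P → (con 1ℤ :- w) :+ w :* (con 1ℤ :- P) := con 1ℤ :- w :* P) refl w (w ^ k) ⟩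
    1# - w ^ suc k ∎
    where
    S : Carrier
    S = geometricSum w k

  unit-1-nilpotent : ∀ {w} → Nilpotent w → Unit (1# - w)
  unit-1-nilpotent {w} (k , wᵏ≈0) = geometricSum w k , (begin
    (1# - w) * geometricSum w k  ≈⟨ geometricSum-telescopes w k ⟩
    1# - w ^ k                   ≈⟨ +-congˡ (-‿cong wᵏ≈0) ⟩
    1# - 0#                      ≈⟨ solve 0 (con 1ℤ :- con 0ℤ := con 1ℤ) refl ⟩
    1#                           ∎)

  unit+nilpotent : ∀ {u z} → Unit u → Nilpotent z → Unit (u + z)
  unit+nilpotent {u} {z} (v , uv≈1) z-nil =
    let s , s-inverse = unit-1-nilpotent (nilpotent-*ˡ (- v) z-nil) in v * s , (begin
    (u + z) * (v * s)        ≈⟨ *-assoc _ _ _ ⟨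
    ((u + z) * v) * s        ≈⟨ *-congʳ (distribʳ v u z) ⟩
    (u * v + z * v) * s      ≈⟨ *-congʳ (+-congʳ uv≈1) ⟩
    (1# + z * v) * s         ≈⟨ *-congʳ (solve 2 (λ z v → con 1ℤ :+ z :* v := con 1ℤ :- (:- v) :* z) refl z v) ⟩
    (1# - (- v) * z) * s     ≈⟨ s-inverse ⟩
    1#                       ∎)

  idempotent-orthogonal : ∀ {e} → Idempotent e → e * (1# - e) ≈ 0#
  idempotent-orthogonal {e} e²≈e = begin
    e * (1# - e)  ≈⟨ solve 1 (λ e → e :* (con 1ℤ :- e) := e :- e :* e) refl e ⟩
    e - e * e     ≈⟨ +-congˡ (-‿cong e²≈e) ⟩
    e - e         ≈⟨ -‿inverseʳ e ⟩
    0#            ∎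

  domain-^-nonzero : IsIntegralDomain B → ∀ {x} → ¬ x ≈ 0# → ∀ k → ¬ x ^ k ≈ 0#
  domain-^-nonzero (1≉0 , _) x≉0 zero = 1≉0
  domain-^-nonzero domain@(_ , no-zero-divisors) {x} x≉0 (suc k) xᵏ⁺¹≈0
    with no-zero-divisors x (x ^ k) xᵏ⁺¹≈0
  ... | inj₁ x≈0  = x≉0 x≈0
  ... | inj₂ xᵏ≈0 = domain-^-nonzero domain x≉0 k xᵏ≈0

  module _ (_≟_ : Decidable₂ _≈_) where

    nonzero-units⇒domain : ¬ 1# ≈ 0# → (∀ {x} → ¬ x ≈ 0# → Unit x) → IsIntegralDomain B
    nonzero-units⇒domain 1≉0 nonzero-unit = 1≉0 , no-zero-divisors
      where
      no-zero-divisors : ∀ a b → a * b ≈ 0# → a ≈ 0# ⊎ b ≈ 0#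
      no-zero-divisors a b ab≈0 with a ≟ 0#
      ... | yes a≈0 = inj₁ a≈0
      ... | no a≉0  = let y , ay≈1 = nonzero-unit a≉0 in inj₂ (begin
        b                ≈⟨ *-identityˡ b ⟨
        1# * b           ≈⟨ *-congʳ ay≈1 ⟨
        (a * y) * b      ≈⟨ solve 3 (λ a b y → (a :* y) :* b := y :* (a :* b)) refl a b y ⟩
        y * (a * b)      ≈⟨ *-congˡ ab≈0 ⟩
        y * 0#           ≈⟨ zeroʳ y ⟩
        0#               ∎)

module FiniteCommutativeRing {b ℓ : Level} (B : CommutativeRing b ℓ) {n : ℕ}
  (enum : Fin n → CommutativeRing.Carrier B)
  (enum-surjective : ∀ x → ∃ λ i → CommutativeRing._≈_ B x (enum i)) where
  open CommutativeRing B
  open import Algebra.Properties.Semiring.Exp semiring using (_^_; ^-homo-*)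
  open import Algebra.Properties.Group +-group using (x∙y⁻¹≈ε⇒x≈y)
  open UnitsAndNilpotents B
  open IntegerCoefficientSolver B
  open import Relation.Binary.Reasoning.Setoid setoid

  index : Carrier → Fin n
  index x = proj₁ (enum-surjective x)

  same-index⇒≈ : ∀ {x y} → index x ≡ index y → x ≈ y
  same-index⇒≈ {x} {y} eq =
    trans (proj₂ (enum-surjective x)) (trans (reflexive (≡.cong enum eq)) (sym (proj₂ (enum-surjective y))))

  injective⇒decidable : (∀ i j → enum i ≈ enum j → i ≡ j) → Decidable₂ _≈_
  injective⇒decidable injective x y = map′ same-index⇒≈
    (λ x≈y → injective _ _ (trans (sym (proj₂ (enum-surjective x))) (trans x≈y (proj₂ (enum-surjective y)))))
    (index x Fin.≟ index y)

  search : ∀ {p} {P : Pred Carrier p} → (∀ {x y} → x ≈ y → P x → P y) → Decidable P → Dec (∃ P)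
  search resp P? = map′ (λ (i , Pi) → enum i , Pi) (λ (x , Px) → index x , resp (proj₂ (enum-surjective x)) Px)
    (Fin.any? (P? ∘ enum))

  periodic⇒idempotent-power : ∀ x a q → x ^ (a ℕ.+ suc q) ≈ x ^ a → ∃ λ m → Idempotent (x ^ suc m)
  periodic⇒idempotent-power x a q period = q ℕ.+ a ℕ.* p , (begin
    x ^ N * x ^ N                      ≡⟨ ≡.cong (λ M → x ^ M * x ^ N) (ℕ.m+[n∸m]≡n a≤N) ⟨
    x ^ (a ℕ.+ (N ℕ.∸ a)) * x ^ N      ≈⟨ absorb (N ℕ.∸ a) (suc a) ⟩
    x ^ (a ℕ.+ (N ℕ.∸ a))              ≡⟨ ≡.cong (x ^_) (ℕ.m+[n∸m]≡n a≤N) ⟩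
    x ^ N                              ∎)
    where
    -- N is a multiple of the period p with N ≥ a.
    p N : ℕ
    p = suc q
    N = suc a ℕ.* p
    a≤N : a ℕ.≤ N
    a≤N = ℕ.≤-trans (ℕ.m≤m*n a p) (ℕ.m≤n+m (a ℕ.* p) p)
    shift : ∀ m → x ^ (a ℕ.+ m) * x ^ p ≈ x ^ (a ℕ.+ m)
    shift m = begin
      x ^ (a ℕ.+ m) * x ^ p
        ≈⟨ *-congʳ (^-homo-* x a m) ⟩
      (x ^ a * x ^ m) * x ^ p
        ≈⟨ solve 3 (λ A M P → (A :* M) :* P := (A :* P) :* M) refl (x ^ a) (x ^ m) (x ^ p) ⟩
      (x ^ a * x ^ p) * x ^ m
        ≈⟨ *-congʳ (trans (sym (^-homo-* x a p)) period) ⟩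
      x ^ a * x ^ m
        ≈⟨ ^-homo-* x a m ⟨
      x ^ (a ℕ.+ m) ∎
    absorb : ∀ m k → x ^ (a ℕ.+ m) * x ^ (k ℕ.* p) ≈ x ^ (a ℕ.+ m)
    absorb m zero    = *-identityʳ _
    absorb m (suc k) = begin
      x ^ (a ℕ.+ m) * x ^ (p ℕ.+ k ℕ.* p)        ≈⟨ *-congˡ (^-homo-* x p (k ℕ.* p)) ⟩
      x ^ (a ℕ.+ m) * (x ^ p * x ^ (k ℕ.* p))    ≈⟨ *-assoc _ _ _ ⟨
      (x ^ (a ℕ.+ m) * x ^ p) * x ^ (k ℕ.* p)    ≈⟨ *-congʳ (shift m) ⟩
      x ^ (a ℕ.+ m) * x ^ (k ℕ.* p)              ≈⟨ absorb m k ⟩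
      x ^ (a ℕ.+ m)                              ∎

  -- Kept abstract: unfolding the pigeonhole witness makes later conversion checks very slow.
  abstract
    idempotent-power : ∀ x → ∃ λ m → Idempotent (x ^ suc m)
    idempotent-power x with i , j , i<j , same ← Fin.pigeonhole (ℕ.n<1+n n) (λ i → index (x ^ toℕ i))
      with q , i+1+q≡j ← ℕ.m≤n⇒∃[o]m+o≡n i<j =
      periodic⇒idempotent-power x (toℕ i) q (begin
        x ^ (toℕ i ℕ.+ suc q)  ≡⟨ ≡.cong (x ^_) (≡.trans (ℕ.+-suc (toℕ i) q) i+1+q≡j) ⟩
        x ^ toℕ j              ≈⟨ same-index⇒≈ same ⟨
        x ^ toℕ i              ∎)

  domain⇒field : IsIntegralDomain B → ∀ {x} → ¬ x ≈ 0# → Unit x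
  domain⇒field domain@(_ , no-zero-divisors) {x} x≉0 =
    let m , idem = idempotent-power x
        e = x ^ suc m
    in [ (λ e≈0 → contradiction e≈0 (domain-^-nonzero domain x≉0 (suc m)))
       , (λ 1-e≈0 → x ^ m , sym (x∙y⁻¹≈ε⇒x≈y 1# e 1-e≈0))
       ]′ (no-zero-divisors e (1# - e) (idempotent-orthogonal idem))

  trivial-idempotents⇒unit⊎nilpotent : (∀ {e} → Idempotent e → e ≈ 0# ⊎ e ≈ 1#) →
                                       ∀ x → Unit x ⊎ Nilpotent x
  trivial-idempotents⇒unit⊎nilpotent trivial x with m , idem ← idempotent-power x with trivial idem
  ... | inj₁ xᵐ⁺¹≈0 = inj₂ (suc m , xᵐ⁺¹≈0)
  ... | inj₂ xᵐ⁺¹≈1 = inj₁ (x ^ m , xᵐ⁺¹≈1)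

  module _ (_≟_ : Decidable₂ _≈_) where

    unit? : Decidable Unit
    unit? x = search (λ y≈z xy≈1 → trans (*-congˡ (sym y≈z)) xy≈1) (λ y → (x * y) ≟ 1#)

    nonzero-nonunit : ¬ 1# ≈ 0# → ¬ IsIntegralDomain B → ∃ λ x → ¬ x ≈ 0# × ¬ Unit x
    nonzero-nonunit 1≉0 not-domain
      with search (λ x≈y (x≉0 , ¬ux) → (λ y≈0 → x≉0 (trans x≈y y≈0)) , (λ uy → ¬ux (unit-resp (sym x≈y) uy)))
                  (λ x → ¬? (x ≟ 0#) ×-dec ¬? (unit? x))
    ... | yes found = found
    ... | no none   = contradiction (nonzero-units⇒domain _≟_ 1≉0 nonzero-unit) not-domain
      where
      nonzero-unit : ∀ {x} → ¬ x ≈ 0# → Unit x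
      nonzero-unit {x} x≉0 with unit? x
      ... | yes ux = ux
      ... | no ¬ux = contradiction (x , x≉0 , ¬ux) none

    module LocalRing (1≉0 : ¬ 1# ≈ 0#) (unit⊎nilpotent : ∀ x → Unit x ⊎ Nilpotent x) where

      NonUnit : Pred Carrier (b ⊔ ℓ)
      NonUnit x = ¬ Unit x

      nonUnit-isPrimeIdeal : IsPrimeIdeal B NonUnit
      nonUnit-isPrimeIdeal = record
        { isIdeal = record
          { resp  = λ x≈y ¬ux uy → ¬ux (unit-resp (sym x≈y) uy)
          ; zero∈ = λ (y , 0y≈1) → 1≉0 (trans (sym 0y≈1) (zeroˡ y))
          ; +∈    = +∈
          ; *∈    = λ _ ¬ua ura → ¬ua (unit-*-cancelˡ ura)
          }
        ; proper  = λ ¬u1 → ¬u1 unit-1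
        ; prime   = prime
        }
        where
        +∈ : ∀ {a b} → NonUnit a → NonUnit b → NonUnit (a + b)
        +∈ {a} {b} ¬ua ¬ub ua+b with unit⊎nilpotent a
        ... | inj₁ ua    = ¬ua ua
        ... | inj₂ a-nil = ¬ub (unit-resp
          (solve 2 (λ a b → (a :+ b) :+ (:- con 1ℤ) :* a := b) refl a b)
          (unit+nilpotent ua+b (nilpotent-*ˡ (- 1#) a-nil)))
        prime : ∀ a b → NonUnit (a * b) → NonUnit a ⊎ NonUnit b
        prime a b ¬uab with unit? a | unit? b
        ... | no ¬ua | _      = inj₁ ¬ua
        ... | yes _  | no ¬ub = inj₂ ¬ub
        ... | yes ua | yes ub = contradiction (unit-* ua ub) ¬uab

      residueField≅𝔽₂ : ¬ (∃ λ x → Unit x × Unit (x - 1#)) → QuotCard B NonUnit 2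
      residueField≅𝔽₂ no-x = bit , surjective , injective
        where
        bit : Fin 2 → Carrier
        bit fzero        = 0#
        bit (fsuc fzero) = 1#
        surjective : ∀ x → ∃ λ i → NonUnit (x - bit i)
        surjective x with unit? x
        ... | yes ux = fsuc fzero , λ ux-1 → no-x (x , ux , ux-1)
        ... | no ¬ux = fzero , λ ux-0 → ¬ux (unit-resp (solve 1 (λ x → x :- con 0ℤ := x) refl x) ux-0)
        injective : ∀ i j → NonUnit (bit i - bit j) → i ≡ j
        injective fzero        fzero        _ = ≡.refl
        injective fzero        (fsuc fzero) ¬u = contradiction
          (unit-resp (solve 0 (:- con 1ℤ := con 0ℤ :- con 1ℤ) refl) (unit-neg unit-1)) ¬u
        injective (fsuc fzero) fzero        ¬u = contradiction
          (unit-resp (solve 0 (con 1ℤ := con 1ℤ :- con 0ℤ) refl) unit-1) ¬u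
        injective (fsuc fzero) (fsuc fzero) _ = ≡.refl

      -- A non-unit t is (1 + t) - 1; a unit t is t x + t (1 - x) for x, x - 1 units, and such x
      -- exists since otherwise the residue field would be 𝔽₂.
      sumOfTwoUnits : (∀ P → IsPrimeIdeal B P → ¬ QuotCard B P 2) → ∀ t → SumOfTwoUnits t
      sumOfTwoUnits no-𝔽₂ t with unit? t
      ... | no ¬ut = 1# + t , unit+nilpotent unit-1 t-nil ,
        unit-resp (solve 1 (λ t → :- con 1ℤ := t :- (con 1ℤ :+ t)) refl t) (unit-neg unit-1)
        where
        t-nil : Nilpotent t
        t-nil with unit⊎nilpotent t
        ... | inj₁ ut    = contradiction ut ¬ut
        ... | inj₂ t-nil = t-nil
      ... | yes ut with search (λ x≈y (ux , ux-1) → unit-resp x≈y ux , unit-resp (+-congʳ x≈y) ux-1)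
                               (λ x → unit? x ×-dec unit? (x - 1#))
      ...   | yes (x , ux , ux-1) = t * x , unit-* ut ux ,
        unit-resp (solve 2 (λ t x → t :* (:- (x :- con 1ℤ)) := t :- t :* x) refl t x) (unit-* ut (unit-neg ux-1))
      ...   | no no-x = contradiction (residueField≅𝔽₂ no-x)
                                      (no-𝔽₂ NonUnit nonUnit-isPrimeIdeal)

module Annihilator {b ℓ : Level} (B : CommutativeRing b (b ⊔ ℓ)) where
  open CommutativeRing B
  open UnitsAndNilpotents B
  open IntegerCoefficientSolver B
  open import Relation.Binary.Reasoning.Setoid setoid

  Ann : Carrier → Pred Carrier (b ⊔ ℓ)
  Ann g x = x * g ≈ 0#

  Ann-isIdeal : ∀ g → IsIdeal B (Ann g)
  Ann-isIdeal g = record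
    { resp  = λ x≈y xg≈0 → trans (*-congʳ (sym x≈y)) xg≈0
    ; zero∈ = zeroˡ g
    ; +∈    = λ {x} {y} xg≈0 yg≈0 → begin
        (x + y) * g    ≈⟨ distribʳ g x y ⟩
        x * g + y * g  ≈⟨ +-cong xg≈0 yg≈0 ⟩
        0# + 0#        ≈⟨ +-identityˡ 0# ⟩
        0#             ∎
    ; *∈    = λ r {x} xg≈0 → begin
        (r * x) * g    ≈⟨ *-assoc r x g ⟩
        r * (x * g)    ≈⟨ *-congˡ xg≈0 ⟩
        r * 0#         ≈⟨ zeroʳ r ⟩
        0#             ∎
    }

  B/Ann : Carrier → CommutativeRing b (b ⊔ ℓ)
  B/Ann g = QuotientRing.R/I B (Ann-isIdeal g)

  -- For idempotent g, B ≅ B/Ann g × B/Ann (1 - g) by the Chinese remainder theorem.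
  module Split {g : Carrier} (g-idem : Idempotent g) where
    private
      h : Carrier
      h = 1# - g
      module G = UnitsAndNilpotents (B/Ann g)
      module H = UnitsAndNilpotents (B/Ann h)
      module G≋ = CommutativeRing (B/Ann g)
      module H≋ = CommutativeRing (B/Ann h)

    g²-g≈0 : g * g - g ≈ 0#
    g²-g≈0 = trans (+-congʳ g-idem) (-‿inverseʳ g)

    unit-glue : ∀ {x} → G.Unit x → H.Unit x → Unit x
    unit-glue {x} (y , [xy-1]g≈0) (z , [xz-1]h≈0) = y * g + z * h , (begin
      x * (y * g + z * h)
        ≈⟨ solve 4 (λ x y z g → x :* (y :* g :+ z :* (con 1ℤ :- g))
                                := (x :* y :- con 1ℤ) :* g :+ (x :* z :- con 1ℤ) :* (con 1ℤ :- g) :+ con 1ℤ)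
                   refl x y z g ⟩
      (x * y - 1#) * g + (x * z - 1#) * h + 1#
        ≈⟨ +-congʳ (+-cong [xy-1]g≈0 [xz-1]h≈0) ⟩
      0# + 0# + 1#
        ≈⟨ solve 0 (con 0ℤ :+ con 0ℤ :+ con 1ℤ := con 1ℤ) refl ⟩
      1# ∎)

    glue-≋ᵍ : ∀ u v → u * g + v * h G≋.≈ u
    glue-≋ᵍ u v = begin
      (u * g + v * h - u) * g
        ≈⟨ solve 3 (λ u v g → (u :* g :+ v :* (con 1ℤ :- g) :- u) :* g := (u :- v) :* (g :* g :- g)) refl u v g ⟩
      (u - v) * (g * g - g)
        ≈⟨ *-congˡ g²-g≈0 ⟩
      (u - v) * 0#
        ≈⟨ zeroʳ _ ⟩
      0# ∎

    glue-≋ʰ : ∀ u v → u * g + v * h H≋.≈ v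
    glue-≋ʰ u v = begin
      (u * g + v * h - v) * h
        ≈⟨ solve 3 (λ u v g → (u :* g :+ v :* (con 1ℤ :- g) :- v) :* (con 1ℤ :- g)
                              := (v :- u) :* (g :* g :- g)) refl u v g ⟩
      (v - u) * (g * g - g)
        ≈⟨ *-congˡ g²-g≈0 ⟩
      (v - u) * 0#
        ≈⟨ zeroʳ _ ⟩
      0# ∎

    sumOfTwoUnits-glue : ∀ {t} → G.SumOfTwoUnits t → H.SumOfTwoUnits t → SumOfTwoUnits t
    sumOfTwoUnits-glue {t} (u , gu , gt-u) (v , hu , ht-v) =
      w , unit-glue (G.unit-resp (G≋.sym (glue-≋ᵍ u v)) gu) (H.unit-resp (H≋.sym (glue-≋ʰ u v)) hu)
        , unit-glue (G.unit-resp (G≋.+-congˡ (G≋.-‿cong (G≋.sym (glue-≋ᵍ u v)))) gt-u)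
                    (H.unit-resp (H≋.+-congˡ (H≋.-‿cong (H≋.sym (glue-≋ʰ u v)))) ht-v)
      where
      w : Carrier
      w = u * g + v * h

module FiniteQuotients {c ℓ : Level} (R : CommutativeRing c ℓ) {n : ℕ}
  (enum : Fin n → CommutativeRing.Carrier R) where
  open CommutativeRing R

  record EnumeratedQuotient (J : Pred Carrier (c ⊔ ℓ)) : Set (c ⊔ ℓ) where
    field
      isIdeal         : IsIdeal R J
      decidable       : Decidable J
      proper          : ¬ J 1#
      enum-surjective : ∀ x → ∃ λ i → J (x - enum i)

  open EnumeratedQuotient

  NoResidueField𝔽₂ : Pred Carrier (c ⊔ ℓ) → Set (lsuc (c ⊔ ℓ))
  NoResidueField𝔽₂ J = ∀ P → IsPrimeIdeal R P → _⊆I_ R J P → ¬ QuotCard R P 2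

  TwoUnitSums : ∀ {J} → EnumeratedQuotient J → Set (c ⊔ ℓ)
  TwoUnitSums J-quot = ∀ t → UnitsAndNilpotents.SumOfTwoUnits (QuotientRing.R/I R (isIdeal J-quot)) t

  -- Ideals are compared through the enumerated elements they contain; this set grows
  -- strictly when an ideal is enlarged, which makes the induction below well founded.
  members : ∀ {J : Pred Carrier (c ⊔ ℓ)} → Decidable J → Subset n
  members J? = tabulate (λ i → if does (J? (enum i)) then inside else outside)

  _⊏_ : ∀ {J K} → EnumeratedQuotient J → EnumeratedQuotient K → Set
  J-quot ⊏ K-quot = members (decidable J-quot) ⊂ members (decidable K-quot)

  ∈-members⁺ : ∀ {J} (J? : Decidable J) {i} → J (enum i) → i ∈ members J?
  ∈-members⁺ J? {i} Jx = lookup⇒[]= i _ (≡.trans (lookup∘tabulate _ i) (helper (J? (enum i))))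
    where
    helper : ∀ d → (if does d then inside else outside) ≡ inside
    helper (yes _)  = ≡.refl
    helper (no ¬Jx) = contradiction Jx ¬Jx

  ∈-members⁻ : ∀ {J} (J? : Decidable J) {i} → i ∈ members J? → J (enum i)
  ∈-members⁻ {J} J? {i} i∈J = helper (J? (enum i)) (≡.trans (≡.sym (lookup∘tabulate _ i)) ([]=⇒lookup i∈J))
    where
    helper : ∀ d → (if does d then inside else outside) ≡ inside → J (enum i)
    helper (yes Jx) _ = Jx
    helper (no _)   ()

  ⊏-enlarge : ∀ {J K} (J-quot : EnumeratedQuotient J) (K-quot : EnumeratedQuotient K) →
              _⊆I_ R J K → ∀ {x} → K x → ¬ J x → J-quot ⊏ K-quot
  ⊏-enlarge J-quot K-quot J⊆K {x} Kx ¬Jx =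
    (λ i∈J → ∈-members⁺ (decidable K-quot) (J⊆K (∈-members⁻ (decidable J-quot) i∈J))) ,
    i , ∈-members⁺ (decidable K-quot) (K.∈-resp-≋ (J⊆K x≋eᵢ) Kx) ,
    λ i∈J → ¬Jx (J.∈-resp-≋ (J.≋-sym x≋eᵢ) (∈-members⁻ (decidable J-quot) i∈J))
    where
    module J = QuotientRing R (isIdeal J-quot)
    module K = QuotientRing R (isIdeal K-quot)
    i : Fin n
    i = proj₁ (enum-surjective J-quot x)
    x≋eᵢ : x J.≋ enum i
    x≋eᵢ = proj₂ (enum-surjective J-quot x)

  module Step {J} (J-quot : EnumeratedQuotient J) (no-𝔽₂ : NoResidueField𝔽₂ J)
    (larger : ∀ {K} (K-quot : EnumeratedQuotient K) → NoResidueField𝔽₂ K → J-quot ⊏ K-quot → TwoUnitSums K-quot)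
    where
    open QuotientRing R (isIdeal J-quot) using (R/I; isIdeal-lift; ⊆-lift; isPrimeIdeal-lift; ∈⇒≋0; ≋0⇒∈)
    private module B = CommutativeRing R/I
    open UnitsAndNilpotents R/I
    open FiniteCommutativeRing R/I enum (enum-surjective J-quot)
    open Annihilator {c} {ℓ} R/I
    open import Algebra.Properties.Group B.+-group using (x∙y⁻¹≈ε⇒x≈y)

    _≟_ : Decidable₂ B._≈_
    x ≟ y = decidable J-quot (x - y)

    Nontrivial : Pred Carrier (c ⊔ ℓ)
    Nontrivial g = Idempotent g × ¬ g B.≈ 0# × ¬ g B.≈ 1#

    nontrivial? : Dec (∃ Nontrivial)
    nontrivial? = search (λ x≈y (x-idem , x≉0 , x≉1) →
        B.trans (B.*-cong (B.sym x≈y) (B.sym x≈y)) (B.trans x-idem x≈y) ,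
        (λ y≈0 → x≉0 (B.trans x≈y y≈0)) , (λ y≈1 → x≉1 (B.trans x≈y y≈1)))
      (λ g → ((g * g) ≟ g) ×-dec ¬? (g ≟ 0#) ×-dec ¬? (g ≟ 1#))

    local-case : ¬ (∃ Nontrivial) → TwoUnitSums J-quot
    local-case none = LocalRing.sumOfTwoUnits _≟_ (proper J-quot ∘ ≋0⇒∈)
      (trivial-idempotents⇒unit⊎nilpotent trivial)
      (λ P P-prime → no-𝔽₂ P (isPrimeIdeal-lift P-prime) (⊆-lift (IsPrimeIdeal.isIdeal P-prime)))
      where
      trivial : ∀ {e} → Idempotent e → e B.≈ 0# ⊎ e B.≈ 1#
      trivial {e} e-idem with e ≟ 0# | e ≟ 1#
      ... | yes e≈0 | _       = inj₁ e≈0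
      ... | no _    | yes e≈1 = inj₂ e≈1
      ... | no e≉0  | no e≉1  = contradiction (e , e-idem , e≉0 , e≉1) none

    -- (R/J)/Ann a is definitionally R/(Ann a), so the hypothesis on larger ideals applies to it.
    annihilator-case : ∀ {a y} → ¬ a B.≈ 0# → y B.* a B.≈ 0# → ¬ y B.≈ 0# →
                       ∀ t → UnitsAndNilpotents.SumOfTwoUnits (B/Ann a) t
    annihilator-case {a} a≉0 ya≈0 y≉0 =
      larger K-quot (λ P P-prime Ann⊆P → no-𝔽₂ P P-prime (Ann⊆P ∘ J⊆Ann))
        (⊏-enlarge J-quot K-quot J⊆Ann ya≈0 (y≉0 ∘ ∈⇒≋0))
      where
      J⊆Ann : _⊆I_ R J (Ann a)
      J⊆Ann = ⊆-lift (Ann-isIdeal a)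
      K-quot : EnumeratedQuotient (Ann a)
      K-quot = record
        { isIdeal         = isIdeal-lift (Ann-isIdeal a)
        ; decidable       = λ x → (x * a) ≟ 0#
        ; proper          = λ 1a≈0 → a≉0 (B.trans (B.sym (B.*-identityˡ a)) 1a≈0)
        ; enum-surjective = λ x → proj₁ (enum-surjective J-quot x) , J⊆Ann (proj₂ (enum-surjective J-quot x))
        }

    split-case : ∀ {g} → Nontrivial g → TwoUnitSums J-quot
    split-case {g} (g-idem , g≉0 , g≉1) t = Split.sumOfTwoUnits-glue g-idem
      (annihilator-case g≉0 (B.trans (B.*-comm _ _) (idempotent-orthogonal g-idem)) 1-g≉0 t)
      (annihilator-case 1-g≉0 (idempotent-orthogonal g-idem) g≉0 t)
      where
      1-g≉0 : ¬ (1# - g) B.≈ 0#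
      1-g≉0 1-g≈0 = g≉1 (B.sym (x∙y⁻¹≈ε⇒x≈y 1# g 1-g≈0))

    twoUnitSums : TwoUnitSums J-quot
    twoUnitSums = by-cases nontrivial?
      where
      by-cases : Dec (∃ Nontrivial) → TwoUnitSums J-quot
      by-cases (no none)              = local-case none
      by-cases (yes (_ , nontrivial)) = split-case nontrivial

  twoUnitSums-acc : ∀ {J} (J-quot : EnumeratedQuotient J) → NoResidueField𝔽₂ J →
                    Acc _⊃_ (members (decidable J-quot)) → TwoUnitSums J-quot
  twoUnitSums-acc J-quot no-𝔽₂ (acc larger) = Step.twoUnitSums J-quot no-𝔽₂
    (λ K-quot no-𝔽₂′ J⊏K → twoUnitSums-acc K-quot no-𝔽₂′ (larger J⊏K))

  twoUnitSums : ∀ {J} (J-quot : EnumeratedQuotient J) → NoResidueField𝔽₂ J → TwoUnitSums J-quot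
  twoUnitSums J-quot no-𝔽₂ = twoUnitSums-acc J-quot no-𝔽₂ (⊃-wellFounded _)

module UnitaryCayleyGraph {c ℓ : Level} (R : CommutativeRing c ℓ)
  {I : Pred (CommutativeRing.Carrier R) (c ⊔ ℓ)} (I-ideal : IsIdeal R I) where
  open CommutativeRing R
  open QuotientRing R I-ideal
  open UnitsAndNilpotents R/I
  open IntegerCoefficientSolver R
  private module Q = CommutativeRing R/I

  hasDiameter-1 : ¬ I 1# → Decidable I → (∀ {x} → ¬ x Q.≈ 0# → Unit x) → HasDiameter R I 1
  hasDiameter-1 1∉I I? nonzero-unit = adjacent-or-equal , 1# , 0# , distinct
    where
    adjacent-or-equal : ∀ a b → Dist≤ R I 1 a b
    adjacent-or-equal a b with I? (a - b)
    ... | yes a≋b = inj₁ a≋b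
    ... | no a≉b  = inj₂ (b , nonzero-unit (a≉b ∘ ≋0⇒∈) , Q.refl)
    distinct : ∀ k → k < 1 → ¬ Dist≤ R I k 1# 0#
    distinct zero _ = 1∉I ∘ ≋0⇒∈
    distinct (suc _) (s≤s ())

  hasDiameter-2 : (∀ t → SumOfTwoUnits t) → (∃ λ x → ¬ I x × ¬ Unit x) → HasDiameter R I 2
  hasDiameter-2 two-units (x , x∉I , ¬ux) = path , x , 0# , distant
    where
    path : ∀ a b → Dist≤ R I 2 a b
    path a b with u , uu , ua-b-u ← two-units (a - b) =
      inj₂ (a - u , unit-resp (≈⇒≋ (solve 2 (λ a u → u := a :- (a :- u)) refl a u)) uu ,
        inj₂ (b , unit-resp (≈⇒≋ (solve 3 (λ a b u → a :- b :- u := a :- u :- b) refl a b u)) ua-b-u , Q.refl))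
    distant : ∀ k → k < 2 → ¬ Dist≤ R I k x 0#
    distant zero          _ = x∉I ∘ ≋0⇒∈
    distant (suc zero)    _ (inj₁ x≋0) = x∉I (≋0⇒∈ x≋0)
    distant (suc zero)    _ (inj₂ (z , ux-z , z≋0)) =
      ¬ux (unit-resp (Q.trans (Q.+-congˡ (Q.-‿cong z≋0)) (≈⇒≋ (solve 1 (λ x → x :- con 0ℤ := x) refl x))) ux-z)
    distant (suc (suc _)) (s≤s (s≤s ()))

theorem6p1 : {c ℓ : Level} (R : CommutativeRing c ℓ) →
    IsDedekindDomain R →
    (I : Pred (CommutativeRing.Carrier R) (c ⊔ ℓ)) →
    IsIdeal R I → NonzeroIdeal R I → FiniteQuot R I →
    ¬ I (CommutativeRing.1# R) →
    (IsPrimeIdeal R I → HasDiameter R I 1) ×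
    (¬ IsPrimeIdeal R I →
      (∀ (P : Pred (CommutativeRing.Carrier R) (c ⊔ ℓ)) →
        IsPrimeIdeal R P → _⊆I_ R I P → ¬ QuotCard R P 2) →
      HasDiameter R I 2)
theorem6p1 R _ I I-ideal _ (_ , enum , surjective , injective) 1∉I = prime-case , nonprime-case
  where
  open CommutativeRing R
  open QuotientRing R I-ideal
  open FiniteCommutativeRing R/I enum surjective
  open UnitaryCayleyGraph R I-ideal
  open FiniteQuotients R enum

  _≟_ : Decidable₂ _≋_
  _≟_ = injective⇒decidable injective

  I? : Decidable I
  I? x = map′ ≋0⇒∈ ∈⇒≋0 (x ≟ 0#)

  prime-case : IsPrimeIdeal R I → HasDiameter R I 1
  prime-case I-prime = hasDiameter-1 1∉I I? (domain⇒field (isPrimeIdeal⇒isIntegralDomain I-prime))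

  nonprime-case : ¬ IsPrimeIdeal R I → NoResidueField𝔽₂ I → HasDiameter R I 2
  nonprime-case I-not-prime no-𝔽₂ =
    let x , x≉0 , ¬ux = nonzero-nonunit _≟_ (1∉I ∘ ≋0⇒∈) (I-not-prime ∘ isIntegralDomain⇒isPrimeIdeal)
    in hasDiameter-2 (twoUnitSums I-quot no-𝔽₂) (x , x≉0 ∘ ∈⇒≋0 , ¬ux)
    where
    I-quot : EnumeratedQuotient I
    I-quot = record { isIdeal = I-ideal ; decidable = I? ; proper = 1∉I ; enum-surjective = surjective }
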